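{- Let $n$ be a positive integer, let $t \geq 1$ be an integer, and suppose $k$ is the least integer with $3 \leq k \leq n-1$ and $\gcd(n,k) = 1$. Then there exists a zero-sum sequence in $(\mathbb{Z}/n\mathbb{Z})^2$ of length $(t+2)n - k$ which contains no zero-sum subsequence of length $nt$.
   Context: A sequence in an abelian group is a finite list of elements (repetitions allowed); a subsequence is obtained by selecting any subset of the positions (not necessarily consecutive). A sequence is zero-sum if its terms sum to $0$. -}

module Defs where

open import Data.Nat using (ℕ; _+_)
open import Data.Nat.Divisibility using (_∣_)
open import Data.Fin using (Fin; toℕ)
open import Data.Product using (_×_; _,_; proj₁; proj₂)
open import Data.List using (List; []; _∷_; map)
open import Data.Nat.ListAction using (sum)
open import Data.Vec using (Vec; []; _∷_)
open import Data.Bool using (Bool; true; false)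
open import Data.Fin.Subset using (Subset)

ZnSq : ℕ → Set
ZnSq n = Fin n × Fin n

Seq : ℕ → ℕ → Set
Seq n L = Vec (ZnSq n) L

-- A list of elements of (ℤ/nℤ)² is zero-sum iff the sum in (ℤ/nℤ)² is 0,
-- i.e. both coordinate sums (of the representatives) are divisible by n.
ZeroSum : {n : ℕ} → List (ZnSq n) → Set
ZeroSum {n} xs = (n ∣ sum (map (λ x → toℕ (proj₁ x)) xs))
               × (n ∣ sum (map (λ x → toℕ (proj₂ x)) xs))

select : {A : Set} {L : ℕ} → Subset L → Vec A L → List A
select [] [] = []
select (true ∷ p) (x ∷ xs) = x ∷ select p xs
select (false ∷ p) (x ∷ xs) = select p xs

module Submission where

-- Write n = m + 1 and r = n - k.  The sequence is the
-- block sequence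
--     S = (1,0)^(r+2) · (0,1)^(nt-1) · (r+2, n-1)^(n-1)
-- of length (r+2) + (nt-1) + (n-1) = (t+2)n - k.  Both coordinate sums,
-- n(r+2) and (nt-1) + (n-1)², are multiples of n, so S is zero-sum.
--
-- A subsequence of a block sequence is again a block sequence
-- (1,0)^a · (0,1)^b · (r+2, n-1)^c with a ≤ r+2, b ≤ nt-1, c ≤ n-1.  If it
-- has length nt and is zero-sum, then n divides a + b + c, a + c(r+2) and
-- b + c(n-1); adding the last two gives n | cr, i.e. n | ck, so c = 0 by
-- coprimality, then n | a with a ≤ r+2 < n (this is where k ≥ 3 is used)
-- gives a = 0, and finally b = nt exceeds the available nt-1 copies.

open import Defs
open import Data.Nat using (ℕ; _+_; _*_; _∸_; _≤_; _<_; zero; suc; s≤s; z≤n)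
open import Data.Nat.GCD using (gcd)
open import Data.List using (length)
open import Data.Product using (Σ; _×_)
open import Data.Fin.Subset using (Subset)
open import Data.Vec using (toList)
open import Relation.Binary.PropositionalEquality using (_≡_)
open import Relation.Nullary using (¬_)

import Data.List as L
import Data.Vec as V
open import Data.List.Properties using (length-++; length-replicate; map-++)
open import Data.Vec.Properties using (toList-++; toList-replicate)
open import Data.Nat.ListAction using (sum)
open import Data.Nat.ListAction.Properties using (sum-++)
open import Data.Nat.Properties
open import Data.Nat.Divisibility using (_∣_; divides; ∣m∣n⇒∣m+n; ∣m+n∣m⇒∣n; n∣m*n; m∣m*n; ∣-refl; >⇒∤)
open import Data.Nat.Coprimality using (Coprime; gcd≡1⇒coprime; coprime-divisor)
open import Data.Nat.Solver using (module +-*-Solver)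
open import Data.Fin using (Fin; toℕ; fromℕ<; fromℕ)
open import Data.Fin.Properties using (toℕ-fromℕ<; toℕ-fromℕ)
open import Data.Product using (∃-syntax; _,_; proj₁; proj₂)
open import Data.Bool using (true; false)
open import Data.Empty using (⊥-elim)
open import Relation.Binary.PropositionalEquality
  using (refl; sym; trans; cong; cong₂; subst; module ≡-Reasoning)

open +-*-Solver using (solve; _:=_; _:+_; _:*_; con)

NoZeroSumSubseqOfLength : {n L : ℕ} → Seq n L → ℕ → Set
NoZeroSumSubseqOfLength {L = L} S ℓ =
  (P : Subset L) → length (select P S) ≡ ℓ → ¬ ZeroSum (select P S)

ZeroSumWithoutSubseqOfLength : (n ℓ L : ℕ) → Set
ZeroSumWithoutSubseqOfLength n ℓ L =
  Σ (Seq n L) (λ S → ZeroSum (toList S) × NoZeroSumSubseqOfLength S ℓ)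

module _ {X : Set} where

  blocks : ℕ → ℕ → ℕ → X → X → X → L.List X
  blocks a b c x y z = L.replicate a x L.++ (L.replicate b y L.++ L.replicate c z)

  blockSeq : (A B C : ℕ) → X → X → X → V.Vec X (A + (B + C))
  blockSeq A B C x y z = V.replicate A x V.++ (V.replicate B y V.++ V.replicate C z)

  toList-blockSeq : ∀ A B C x y z → toList (blockSeq A B C x y z) ≡ blocks A B C x y z
  toList-blockSeq A B C x y z = begin
    toList (blockSeq A B C x y z)
      ≡⟨ toList-++ (V.replicate A x) _ ⟩
    toList (V.replicate A x) L.++ toList (V.replicate B y V.++ V.replicate C z)
      ≡⟨ cong₂ L._++_ (toList-replicate A x)
           (trans (toList-++ (V.replicate B y) _)
                  (cong₂ L._++_ (toList-replicate B y) (toList-replicate C z))) ⟩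
    blocks A B C x y z ∎
    where open ≡-Reasoning

  length-blocks : ∀ a b c x y z → length (blocks a b c x y z) ≡ a + (b + c)
  length-blocks a b c x y z = begin
    length (blocks a b c x y z)
      ≡⟨ length-++ (L.replicate a x) ⟩
    length (L.replicate a x) + length (L.replicate b y L.++ L.replicate c z)
      ≡⟨ cong₂ _+_ (length-replicate a) (trans (length-++ (L.replicate b y))
           (cong₂ _+_ (length-replicate b) (length-replicate c))) ⟩
    a + (b + c) ∎
    where open ≡-Reasoning

  sum-map-replicate : (f : X → ℕ) (a : ℕ) (x : X) → sum (L.map f (L.replicate a x)) ≡ a * f x
  sum-map-replicate f zero    x = refl
  sum-map-replicate f (suc a) x = cong (f x +_) (sum-map-replicate f a x)

  sum-map-++ : (f : X → ℕ) (xs ys : L.List X)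
    → sum (L.map f (xs L.++ ys)) ≡ sum (L.map f xs) + sum (L.map f ys)
  sum-map-++ f xs ys = trans (cong sum (map-++ f xs ys)) (sum-++ (L.map f xs) (L.map f ys))

  sum-map-blocks : (f : X → ℕ) → ∀ a b c x y z
    → sum (L.map f (blocks a b c x y z)) ≡ a * f x + (b * f y + c * f z)
  sum-map-blocks f a b c x y z = begin
    sum (L.map f (blocks a b c x y z))
      ≡⟨ sum-map-++ f (L.replicate a x) _ ⟩
    sum (L.map f (L.replicate a x)) + sum (L.map f (L.replicate b y L.++ L.replicate c z))
      ≡⟨ cong₂ _+_ (sum-map-replicate f a x) (trans (sum-map-++ f (L.replicate b y) _)
           (cong₂ _+_ (sum-map-replicate f b y) (sum-map-replicate f c z))) ⟩
    a * f x + (b * f y + c * f z) ∎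
    where open ≡-Reasoning

  select-++ : ∀ {A B} (P : Subset (A + B)) (u : V.Vec X A) (v : V.Vec X B)
    → ∃[ Q ] ∃[ R ] select P (u V.++ v) ≡ select Q u L.++ select R v
  select-++ P V.[] v = V.[] , P , refl
  select-++ (true V.∷ P) (x V.∷ u) v =
    let Q , R , eq = select-++ P u v in true V.∷ Q , R , cong (x L.∷_) eq
  select-++ (false V.∷ P) (x V.∷ u) v =
    let Q , R , eq = select-++ P u v in false V.∷ Q , R , eq

  select-replicate : ∀ {A} (P : Subset A) (x : X)
    → ∃[ a ] a ≤ A × select P (V.replicate A x) ≡ L.replicate a x
  select-replicate V.[] x = 0 , z≤n , refl
  select-replicate (true V.∷ P) x =
    let a , a≤ , eq = select-replicate P x in suc a , s≤s a≤ , cong (x L.∷_) eq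
  select-replicate (false V.∷ P) x =
    let a , a≤ , eq = select-replicate P x in a , m≤n⇒m≤1+n a≤ , eq

  select-blockSeq : ∀ {A B C} (P : Subset (A + (B + C))) (x y z : X)
    → ∃[ a ] ∃[ b ] ∃[ c ] a ≤ A × b ≤ B × c ≤ C
        × select P (blockSeq A B C x y z) ≡ blocks a b c x y z
  select-blockSeq {A} {B} {C} P x y z
    with Q , R , eq₁ ← select-++ P (V.replicate A x) (V.replicate B y V.++ V.replicate C z)
    with Q′ , R′ , eq₂ ← select-++ R (V.replicate B y) (V.replicate C z)
    with a , a≤ , eqa ← select-replicate Q x
    with b , b≤ , eqb ← select-replicate Q′ y
    with c , c≤ , eqc ← select-replicate R′ z
    = a , b , c , a≤ , b≤ , c≤
    , trans eq₁ (cong₂ L._++_ eqa (trans eq₂ (cong₂ L._++_ eqb eqc)))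

multiple-below-≡0 : ∀ {n c} → n ∣ c → c < n → c ≡ 0
multiple-below-≡0 {c = zero}  _   _   = refl
multiple-below-≡0 {c = suc c} n∣c c<n = ⊥-elim (>⇒∤ c<n n∣c)

counts-vanish : ∀ {m k r a b c t} → Coprime (suc m) k → k + r ≡ suc m
  → a < suc m → c < suc m → a + (b + c) ≡ suc m * t
  → suc m ∣ a + c * (r + 2) → suc m ∣ b + c * m → a ≡ 0 × c ≡ 0
counts-vanish {m} {k} {r} {a} {b} {c} {t} coprime k+r≡n a<n c<n total n∣fst n∣snd =
  a≡0 , c≡0
  where
  n = suc m
  regroup : (a + c * (r + 2)) + (b + c * m) ≡ (a + (b + c) + c * n) + c * r
  regroup = solve 5 (λ a b c r m → (a :+ c :* (r :+ con 2)) :+ (b :+ c :* m)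
              := (a :+ (b :+ c) :+ c :* (con 1 :+ m)) :+ c :* r) refl a b c r m
  n∣cr : n ∣ c * r
  n∣cr = ∣m+n∣m⇒∣n (subst (n ∣_) regroup (∣m∣n⇒∣m+n n∣fst n∣snd))
           (subst (λ s → n ∣ s + c * n) (sym total) (∣m∣n⇒∣m+n (m∣m*n t) (n∣m*n c)))
  split-cn : c * n ≡ k * c + c * r
  split-cn = begin
    c * n           ≡⟨ cong (c *_) (sym k+r≡n) ⟩
    c * (k + r)     ≡⟨ *-distribˡ-+ c k r ⟩
    c * k + c * r   ≡⟨ cong (_+ c * r) (*-comm c k) ⟩
    k * c + c * r   ∎
    where open ≡-Reasoning
  n∣kc : n ∣ k * c
  n∣kc = ∣m+n∣m⇒∣n (subst (n ∣_) (trans split-cn (+-comm (k * c) (c * r))) (n∣m*n c)) n∣cr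
  c≡0 : c ≡ 0
  c≡0 = multiple-below-≡0 (coprime-divisor coprime n∣kc) c<n
  a≡0 : a ≡ 0
  a≡0 = multiple-below-≡0
          (subst (n ∣_) (trans (cong (λ c → a + c * (r + 2)) c≡0) (+-identityʳ a)) n∣fst) a<n

module Construction {m k r t w : ℕ} (3≤k : 3 ≤ k) (coprime : Coprime (suc m) k)
                    (k+r≡n : k + r ≡ suc m) (nt≡1+w : suc m * t ≡ suc w) where

  n : ℕ
  n = suc m

  -- k ≥ 3 makes r + 2 a proper residue.
  r+2<n : r + 2 < n
  r+2<n = subst (r + 2 <_) k+r≡n
            (subst (_≤ k + r) (trans (+-comm 3 r) (+-suc r 2)) (+-monoˡ-≤ r 3≤k))

  1<n : 1 < n
  1<n = ≤-trans (s≤s (s≤s z≤n)) (≤-trans (m≤n+m 2 r) (<⇒≤ r+2<n))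

  one : Fin n
  one = fromℕ< 1<n

  -- The generators (1,0), (0,1) and (r+2, m) = (r+2, -1).
  g₁ g₂ g₃ : ZnSq n
  g₁ = one , Fin.zero
  g₂ = Fin.zero , one
  g₃ = fromℕ< r+2<n , fromℕ m

  S : Seq n ((r + 2) + (w + m))
  S = blockSeq (r + 2) w m g₁ g₂ g₃

  fst-sum : ∀ a b c → sum (L.map (λ g → toℕ (proj₁ g)) (blocks a b c g₁ g₂ g₃)) ≡ a + c * (r + 2)
  fst-sum a b c = begin
    sum (L.map (λ g → toℕ (proj₁ g)) (blocks a b c g₁ g₂ g₃))
      ≡⟨ sum-map-blocks (λ g → toℕ (proj₁ g)) a b c g₁ g₂ g₃ ⟩
    a * toℕ one + (b * 0 + c * toℕ (fromℕ< r+2<n))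
      ≡⟨ cong₂ (λ x y → a * x + (b * 0 + c * y)) (toℕ-fromℕ< 1<n) (toℕ-fromℕ< r+2<n) ⟩
    a * 1 + (b * 0 + c * (r + 2))
      ≡⟨ cong₂ (λ x y → x + (y + c * (r + 2))) (*-identityʳ a) (*-zeroʳ b) ⟩
    a + c * (r + 2) ∎
    where open ≡-Reasoning

  snd-sum : ∀ a b c → sum (L.map (λ g → toℕ (proj₂ g)) (blocks a b c g₁ g₂ g₃)) ≡ b + c * m
  snd-sum a b c = begin
    sum (L.map (λ g → toℕ (proj₂ g)) (blocks a b c g₁ g₂ g₃))
      ≡⟨ sum-map-blocks (λ g → toℕ (proj₂ g)) a b c g₁ g₂ g₃ ⟩
    a * 0 + (b * toℕ one + c * toℕ (fromℕ m))
      ≡⟨ cong₂ (λ x y → a * 0 + (b * x + c * y)) (toℕ-fromℕ< 1<n) (toℕ-fromℕ m) ⟩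
    a * 0 + (b * 1 + c * m)
      ≡⟨ cong₂ (λ x y → x + (y + c * m)) (*-zeroʳ a) (*-identityʳ b) ⟩
    b + c * m ∎
    where open ≡-Reasoning

  S-zeroSum : ZeroSum (toList S)
  S-zeroSum rewrite toList-blockSeq (r + 2) w m g₁ g₂ g₃ = n∣fst , n∣snd
    where
    n∣fst : n ∣ sum (L.map (λ g → toℕ (proj₁ g)) (blocks (r + 2) w m g₁ g₂ g₃))
    n∣fst = divides (r + 2) (trans (fst-sum (r + 2) w m)
              (solve 2 (λ r m → (r :+ con 2) :+ m :* (r :+ con 2) := (r :+ con 2) :* (con 1 :+ m))
                 refl r m))
    -- n + (w + m²) = (w + 1) + mn = nt + mn
    n∣w+m² : n ∣ w + m * m
    n∣w+m² = ∣m+n∣m⇒∣n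
      (subst (n ∣_) (trans (cong (_+ m * n) nt≡1+w)
                (solve 2 (λ w m → (con 1 :+ w) :+ m :* (con 1 :+ m) := (con 1 :+ m) :+ (w :+ m :* m))
                   refl w m))
             (∣m∣n⇒∣m+n (m∣m*n t) (n∣m*n m)))
      ∣-refl
    n∣snd : n ∣ sum (L.map (λ g → toℕ (proj₂ g)) (blocks (r + 2) w m g₁ g₂ g₃))
    n∣snd = subst (n ∣_) (sym (snd-sum (r + 2) w m)) n∣w+m²

  -- A zero-sum subsequence of length nt would be (1,0)^a (0,1)^b (r+2,m)^c
  -- with a = c = 0 by counts-vanish, hence b = nt > w.
  S-noZeroSumSubseq : NoZeroSumSubseqOfLength S (n * t)
  S-noZeroSumSubseq P len (n∣fst , n∣snd)
    with a , b , c , a≤ , b≤ , c≤ , shape ← select-blockSeq P g₁ g₂ g₃ =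
    <-irrefl refl (≤-trans (≤-reflexive (sym b≡1+w)) b≤)
    where
    total : a + (b + c) ≡ n * t
    total = trans (sym (length-blocks a b c g₁ g₂ g₃)) (trans (cong length (sym shape)) len)
    vanish : a ≡ 0 × c ≡ 0
    vanish = counts-vanish coprime k+r≡n (≤-<-trans a≤ r+2<n) (s≤s c≤) total
      (subst (n ∣_) (trans (cong (λ xs → sum (L.map (λ g → toℕ (proj₁ g)) xs)) shape) (fst-sum a b c)) n∣fst)
      (subst (n ∣_) (trans (cong (λ xs → sum (L.map (λ g → toℕ (proj₂ g)) xs)) shape) (snd-sum a b c)) n∣snd)
    b≡1+w : b ≡ suc w
    b≡1+w = begin
      b             ≡⟨ sym (+-identityʳ b) ⟩
      b + 0         ≡⟨ cong₂ (λ a c → a + (b + c)) (sym (proj₁ vanish)) (sym (proj₂ vanish)) ⟩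
      a + (b + c)   ≡⟨ total ⟩
      n * t         ≡⟨ nt≡1+w ⟩
      suc w         ∎
      where open ≡-Reasoning

  witness : ZeroSumWithoutSubseqOfLength n (n * t) ((r + 2) + (w + m))
  witness = S , S-zeroSum , S-noZeroSumSubseq

  length-S : (t + 2) * n ∸ k ≡ (r + 2) + (w + m)
  length-S = trans (cong (_∸ k) expand) (m+n∸m≡n k _)
    where
    open ≡-Reasoning
    expand : (t + 2) * n ≡ k + ((r + 2) + (w + m))
    expand = begin
      (t + 2) * n                  ≡⟨ solve 2 (λ t m → (t :+ con 2) :* (con 1 :+ m)
                                       := (con 1 :+ m) :+ ((con 1 :+ m) :* t :+ (con 1 :+ m))) refl t m ⟩
      n + (n * t + n)              ≡⟨ cong₂ (λ x y → x + (y + n)) (sym k+r≡n) nt≡1+w ⟩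
      (k + r) + (suc w + suc m)    ≡⟨ solve 4 (λ k r w m → (k :+ r) :+ ((con 1 :+ w) :+ (con 1 :+ m))
                                       := k :+ ((r :+ con 2) :+ (w :+ m))) refl k r w m ⟩
      k + ((r + 2) + (w + m))      ∎

-- Proposition 2.1.
proposition2p1 : (n t k : ℕ) → 1 ≤ n → 1 ≤ t
  → 3 ≤ k → k ≤ n ∸ 1 → gcd n k ≡ 1
  → (∀ j → 3 ≤ j → j ≤ n ∸ 1 → gcd n j ≡ 1 → k ≤ j)
  → Σ (Seq n ((t + 2) * n ∸ k)) (λ S →
      ZeroSum (toList S)
      × ((P : Subset ((t + 2) * n ∸ k)) → length (select P S) ≡ n * t
         → ¬ ZeroSum (select P S)))
proposition2p1 zero    t k () _ _ _ _ _
proposition2p1 (suc m) t k _ 1≤t 3≤k k≤n-1 gcd≡1 _ =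
  subst (ZeroSumWithoutSubseqOfLength n (n * t)) (sym length-S) witness
  where
  n = suc m
  k+r≡n : k + (n ∸ k) ≡ n
  k+r≡n = m+[n∸m]≡n (≤-trans k≤n-1 (m∸n≤m n 1))
  nt≡1+w : n * t ≡ suc (n * t ∸ 1)
  nt≡1+w = sym (m+[n∸m]≡n (*-mono-≤ (s≤s (z≤n {m})) 1≤t))
  open Construction 3≤k (gcd≡1⇒coprime gcd≡1) k+r≡n nt≡1+w using (witness; length-S)
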